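{- For every finite graph $G$, $\gamma(G)\le \gamma_{\rm MB}(G)\le \gamma_{\rm MB}'(G)$. Moreover, for any integers $r,s,t$ with $2\le r\le s\le t$ there exists a graph $G$ such that $\gamma(G)=r$, $\gamma_{\rm MB}(G)=s$ and $\gamma_{\rm MB}'(G)=t$.
   Context: All graphs are finite and simple. $\gamma(G)$ is the domination number of $G$ (minimum size of a dominating set). The Maker-Breaker domination game on $G$ is played by Dominator and Staller, who alternately select a vertex of $G$ not selected before. Dominator wins if at some point the set of vertices he has selected is a dominating set of $G$; Staller wins otherwise. In the D-game Dominator moves first; in the S-game Staller moves first. $\gamma_{\rm MB}(G)$ is the minimum $k$ such that Dominator has a strategy in the D-game guaranteeing that his selected vertices dominate $G$ after at most $k$ of his moves, whatever Staller does, and $\gamma_{\rm MB}(G)=\infty$ if Dominator has no winning strategy in the D-game; $\gamma_{\rm MB}'(G)$ is defined analogously for the S-game. Inequalities are understood with the convention that $\infty$ is larger than every integer. -}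

module Defs where

open import Data.Nat using (ℕ; zero; suc; _≤_)
open import Data.Bool using (Bool; true; false)
open import Data.Fin using (Fin)
open import Data.Fin.Subset using (Subset; _∈_; _∉_; _∪_; ⁅_⁆; ⊥; ∣_∣)
open import Data.Product using (Σ; ∃; _×_)
open import Data.Sum using (_⊎_)
open import Relation.Binary.PropositionalEquality using (_≡_)

record Graph (n : ℕ) : Set where
  field
    adj    : Fin n → Fin n → Bool
    sym    : ∀ u v → adj u v ≡ adj v u
    irrefl : ∀ v → adj v v ≡ false
open Graph public

module _ {n : ℕ} (G : Graph n) where

  Dominates : Subset n → Set
  Dominates D = ∀ v → v ∈ D ⊎ (∃ λ u → u ∈ D × adj G u v ≡ true)

  IsDomNum : ℕ → Set
  IsDomNum k = (∃ λ D → Dominates D × ∣ D ∣ ≡ k)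
             × (∀ D → Dominates D → k ≤ ∣ D ∣)

  -- Game positions: D = Dominator's vertices, S = Staller's vertices.
  -- WinD k D S : Dominator to move; Dominator can force that his set
  --              dominates G within at most k further moves of his.
  -- The game ends (Staller wins) when no unselected vertex remains and D
  -- does not dominate G.
  data WinD : ℕ → Subset n → Subset n → Set
  data WinS : ℕ → Subset n → Subset n → Set

  data WinD where
    doneD : ∀ {k D S} → Dominates D → WinD k D S
    move  : ∀ {k D S} (v : Fin n) → v ∉ D → v ∉ S →
            WinS k (D ∪ ⁅ v ⁆) S → WinD (suc k) D S

  data WinS where
    doneS : ∀ {k D S} → Dominates D → WinS k D S
    stall : ∀ {k D S} →
            (∃ λ w → w ∉ D × w ∉ S) →
            (∀ w → w ∉ D → w ∉ S → WinD k D (S ∪ ⁅ w ⁆)) →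
            WinS k D S

data ℕ∞ : Set where
  fin : ℕ → ℕ∞
  ∞   : ℕ∞

data _≤∞_ : ℕ∞ → ℕ∞ → Set where
  fin≤fin : ∀ {a b} → a ≤ b → fin a ≤∞ fin b
  _≤∞∞    : ∀ a → a ≤∞ ∞

module _ {n : ℕ} (G : Graph n) where

  IsγMB : ℕ∞ → Set
  IsγMB (fin k) = WinD G k ⊥ ⊥ × (∀ j → WinD G j ⊥ ⊥ → k ≤ j)
  IsγMB ∞       = ∀ j → WinD G j ⊥ ⊥ → Data.Empty.⊥
    where import Data.Empty

  IsγMB' : ℕ∞ → Set
  IsγMB' (fin k) = WinS G k ⊥ ⊥ × (∀ j → WinS G j ⊥ ⊥ → k ≤ j)
  IsγMB' ∞       = ∀ j → WinS G j ⊥ ⊥ → Data.Empty.⊥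
    where import Data.Empty

module Submission where

-- γ(G) ≤ γ_MB(G) since a winning play of Dominator ends with a dominating set of his vertices, and
-- γ_MB(G) ≤ γ'_MB(G) since a vertex owned by Staller never helps Dominator: in the D-game he may
-- pretend that Staller has opened the S-game on some vertex and follow his S-game strategy.
--
-- For the realisation take two hubs hA, hB and disjoint edges ("pairs") split into regions A, B, C
-- of sizes a ≥ b ≥ 1 and c: hA (hB) is joined to both ends of every pair of A (B), and C-pairs are
-- isolated edges.  Then γ = c + 2, γ_MB = b + c + 1 and γ'_MB = a + c + 1.  The upper bounds are
-- pairing strategies: Dominator takes a hub, or answers Staller inside the same pair.  The lower
-- bounds come from a potential which counts, for each hub, 0 if Dominator owns it, the number of
-- its unclaimed pairs if Staller owns it and at most 1 if it is free, plus the number of unclaimed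
-- C-pairs: it never drops on Staller's moves, drops by at most one on Dominator's, and is 0 once
-- Dominator dominates.

open import Defs hiding (sym)
open import Data.Empty using (⊥-elim)
open import Data.Unit using (⊤; tt)
open import Data.Nat using (ℕ; zero; suc; _+_; _⊓_; _≤_; z≤n; s≤s)
open import Data.Nat.Properties
  using (≤-refl; ≤-trans; ≤-pred; m≤m+n; m≤n⇒m≤1+n; m≤n⇒∃[o]m+o≡n; +-suc; +-comm; +-identityʳ;
         +-mono-≤; +-monoˡ-≤; +-monoʳ-≤; m⊓n≤m; m⊓n≤n; ⊓-monoʳ-≤; module ≤-Reasoning)
open import Data.Nat.Tactic.RingSolver using (solve-∀)
open import Data.Bool using (Bool; true; false; not; _∧_; _∨_; _xor_)
open import Data.Bool.Properties using (∨-zeroʳ; ∧-zeroʳ; not-¬; xor-comm; xor-same) renaming (_≟_ to _≟ᴮ_)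
open import Data.Product using (Σ; ∃; _×_; _,_; proj₁; proj₂)
open import Data.Sum using (_⊎_; inj₁; inj₂; [_,_]′)
open import Data.Fin using (Fin; zero; suc; _↑ˡ_; _↑ʳ_; splitAt)
open import Data.Fin.Properties
  using (_≟_; any?; splitAt-↑ˡ; splitAt-↑ʳ; splitAt⁻¹-↑ˡ; splitAt⁻¹-↑ʳ)
open import Data.Fin.Subset
  using (Subset; inside; outside; ∁; _∈_; _∉_; _∪_; _∩_; _-_; _⊆_; ⁅_⁆; ∣_∣; Nonempty)
  renaming (⊥ to ∅)
open import Data.Fin.Subset.Properties
  using (_∈?_; nonempty?; ∉⊥; ∣⊥∣≡0; ∣⊤∣≡n; ∣⁅x⁆∣≡1; x∈p∪q⁺; x∈p∪q⁻; x∈p∩q⁺; x∈p∩q⁻;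
         x∈⁅x⁆; x∈⁅y⁆⇒x≡y; x∉p⇒x∈∁p; x∈∁p⇒x∉p; p⊆p∪q; q⊆p∪q; p─q⊆p; x∈p∧x≢y⇒x∈p-y;
         x∈p⇒∣p-x∣<∣p∣; p⊆q⇒∣p∣≤∣q∣; Empty-unique; ⊆-antisym)
open import Data.Vec using (Vec; []; _∷_; _++_; here; there; lookup; map; replicate; tabulate)
open import Data.Vec.Properties
  using (lookup⇒[]=; []=⇒lookup; lookup∘tabulate; lookup-map; map-++; map-replicate)
open import Function using (case_of_)
open import Relation.Binary.PropositionalEquality
  using (_≡_; _≢_; refl; sym; trans; cong; cong₂; subst; subst₂)
open import Relation.Nullary using (¬_; Dec; yes; no; does)
open import Relation.Nullary.Decidable using (map′; _×-dec_; _⊎-dec_)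

∈-∪⁅⁆⁻ : ∀ {n} {D : Subset n} {u v} → u ∈ D ∪ ⁅ v ⁆ → u ∈ D ⊎ u ≡ v
∈-∪⁅⁆⁻ {D = D} {v = v} u∈ with x∈p∪q⁻ D ⁅ v ⁆ u∈
... | inj₁ u∈D   = inj₁ u∈D
... | inj₂ u∈⁅v⁆ = inj₂ (x∈⁅y⁆⇒x≡y v u∈⁅v⁆)

∉-∪⁅⁆ : ∀ {n} {D : Subset n} {u v} → u ∉ D → v ≢ u → u ∉ D ∪ ⁅ v ⁆
∉-∪⁅⁆ u∉D v≢u u∈ with ∈-∪⁅⁆⁻ u∈
... | inj₁ u∈D  = u∉D u∈D
... | inj₂ refl = v≢u refl

∈-∪⁅⁆ʳ : ∀ {n} {D : Subset n} {v} → v ∈ D ∪ ⁅ v ⁆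
∈-∪⁅⁆ʳ = x∈p∪q⁺ (inj₂ (x∈⁅x⁆ _))

⊆-∪⁅⁆ : ∀ {n} {D : Subset n} {v} → D ⊆ D ∪ ⁅ v ⁆
⊆-∪⁅⁆ u∈D = x∈p∪q⁺ (inj₁ u∈D)

x∉p-x : ∀ {n} (p : Subset n) x → x ∉ p - x
x∉p-x (_ ∷ p) zero    ()
x∉p-x (_ ∷ p) (suc x) (there x∈) = x∉p-x p x x∈

p-x⊆q⇒p⊆q : ∀ {n} {p q : Subset n} {x} → x ∈ q → p - x ⊆ q → p ⊆ q
p-x⊆q⇒p⊆q {x = x} x∈q p-x⊆q {u} u∈p with u ≟ x
... | yes refl = x∈q
... | no u≢x   = p-x⊆q (x∈p∧x≢y⇒x∈p-y u∈p u≢x)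

p≡p-x∪⁅x⁆ : ∀ {n} {p : Subset n} {x} → x ∈ p → p ≡ (p - x) ∪ ⁅ x ⁆
p≡p-x∪⁅x⁆ {p = p} {x} x∈p = ⊆-antisym (p-x⊆q⇒p⊆q ∈-∪⁅⁆ʳ ⊆-∪⁅⁆) back
  where
  back : (p - x) ∪ ⁅ x ⁆ ⊆ p
  back u∈ with ∈-∪⁅⁆⁻ u∈
  ... | inj₁ u∈p-x = p─q⊆p p ⁅ x ⁆ u∈p-x
  ... | inj₂ refl  = x∈p

∣p∪q∣≤∣p∣+∣q∣ : ∀ {n} (p q : Subset n) → ∣ p ∪ q ∣ ≤ ∣ p ∣ + ∣ q ∣
∣p∪q∣≤∣p∣+∣q∣ []            []            = z≤n
∣p∪q∣≤∣p∣+∣q∣ (outside ∷ p) (outside ∷ q) = ∣p∪q∣≤∣p∣+∣q∣ p q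
∣p∪q∣≤∣p∣+∣q∣ (outside ∷ p) (inside ∷ q)  =
  subst (suc ∣ p ∪ q ∣ ≤_) (sym (+-suc ∣ p ∣ ∣ q ∣)) (s≤s (∣p∪q∣≤∣p∣+∣q∣ p q))
∣p∪q∣≤∣p∣+∣q∣ (inside ∷ p)  (outside ∷ q) = s≤s (∣p∪q∣≤∣p∣+∣q∣ p q)
∣p∪q∣≤∣p∣+∣q∣ (inside ∷ p)  (inside ∷ q)  =
  s≤s (subst (∣ p ∪ q ∣ ≤_) (sym (+-suc ∣ p ∣ ∣ q ∣)) (m≤n⇒m≤1+n (∣p∪q∣≤∣p∣+∣q∣ p q)))

∣p∪⁅x⁆∣≤1+∣p∣ : ∀ {n} (p : Subset n) x → ∣ p ∪ ⁅ x ⁆ ∣ ≤ suc ∣ p ∣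
∣p∪⁅x⁆∣≤1+∣p∣ p x = subst (∣ p ∪ ⁅ x ⁆ ∣ ≤_) ∣p∣+1≡1+∣p∣ (∣p∪q∣≤∣p∣+∣q∣ p ⁅ x ⁆)
  where
  ∣p∣+1≡1+∣p∣ : ∣ p ∣ + ∣ ⁅ x ⁆ ∣ ≡ suc ∣ p ∣
  ∣p∣+1≡1+∣p∣ rewrite ∣⁅x⁆∣≡1 x = +-comm ∣ p ∣ 1

∣p∪q∣≤∣q∣+m : ∀ {n} (p q : Subset n) {m} → ∣ p ∣ ≤ m → ∣ p ∪ q ∣ ≤ ∣ q ∣ + m
∣p∪q∣≤∣q∣+m p q {m} ∣p∣≤m =
  ≤-trans (∣p∪q∣≤∣p∣+∣q∣ p q) (subst (∣ p ∣ + ∣ q ∣ ≤_) (+-comm m ∣ q ∣) (+-monoˡ-≤ ∣ q ∣ ∣p∣≤m))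

∣p-x∣≤pred : ∀ {n} {p : Subset n} {x m} → x ∈ p → ∣ p ∣ ≤ m →
             ∃ λ m′ → m ≡ suc m′ × ∣ p - x ∣ ≤ m′
∣p-x∣≤pred {m = suc m′} x∈p ∣p∣≤m = m′ , refl , ≤-pred (≤-trans (x∈p⇒∣p-x∣<∣p∣ x∈p) ∣p∣≤m)
∣p-x∣≤pred {m = zero}   x∈p ∣p∣≤m with ≤-trans (x∈p⇒∣p-x∣<∣p∣ x∈p) ∣p∣≤m
... | ()

1≤∣p∣⇒nonempty : ∀ {n} {p : Subset n} → 1 ≤ ∣ p ∣ → Nonempty p
1≤∣p∣⇒nonempty {n} {p} 1≤∣p∣ with nonempty? p
... | yes p≢∅ = p≢∅
... | no empty with subst (λ q → 1 ≤ ∣ q ∣) (Empty-unique empty) 1≤∣p∣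
...   | 1≤∣∅∣ rewrite ∣⊥∣≡0 n with 1≤∣∅∣
...     | ()

∣p++q∣≡∣p∣+∣q∣ : ∀ {m n} (p : Subset m) (q : Subset n) → ∣ p ++ q ∣ ≡ ∣ p ∣ + ∣ q ∣
∣p++q∣≡∣p∣+∣q∣ []            q = refl
∣p++q∣≡∣p∣+∣q∣ (outside ∷ p) q = ∣p++q∣≡∣p∣+∣q∣ p q
∣p++q∣≡∣p∣+∣q∣ (inside ∷ p)  q = cong suc (∣p++q∣≡∣p∣+∣q∣ p q)

∈-++ˡ : ∀ {m n} {p : Subset m} {q : Subset n} {x} → x ∈ p → x ↑ˡ n ∈ p ++ q
∈-++ˡ here        = here
∈-++ˡ (there x∈p) = there (∈-++ˡ x∈p)

1⊓n≡1 : ∀ {n} → 1 ≤ n → 1 ⊓ n ≡ 1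
1⊓n≡1 (s≤s z≤n) = refl

+-mono-≤-sucᵐ : ∀ {x x′ y y′ z z′} → x ≤ x′ → y ≤ suc y′ → z ≤ z′ →
                x + y + z ≤ suc (x′ + y′ + z′)
+-mono-≤-sucᵐ {x} {x′} {y} {y′} {z} {z′} p q r =
  subst (x + y + z ≤_) (cong (_+ z′) (+-suc x′ y′)) (+-mono-≤ (+-mono-≤ p q) r)

+-mono-≤-sucʳ : ∀ {x x′ y y′ z z′} → x ≤ x′ → y ≤ y′ → z ≤ suc z′ →
                x + y + z ≤ suc (x′ + y′ + z′)
+-mono-≤-sucʳ {x} {x′} {y} {y′} {z} {z′} p q r =
  subst (x + y + z ≤_) (+-suc (x′ + y′) z′) (+-mono-≤ (+-mono-≤ p q) r)

-- The game

module _ {n : ℕ} {G : Graph n} where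

  private variable
    k k′ : ℕ
    D S S′ : Subset n

  WinD-mono : k ≤ k′ → WinD G k D S → WinD G k′ D S
  WinS-mono : k ≤ k′ → WinS G k D S → WinS G k′ D S
  WinD-mono _          (doneD dom)          = doneD dom
  WinD-mono (s≤s k≤k′) (move v v∉D v∉S win) = move v v∉D v∉S (WinS-mono k≤k′ win)
  WinS-mono _          (doneS dom)          = doneS dom
  WinS-mono k≤k′       (stall free win)     = stall free λ w w∉D w∉S → WinD-mono k≤k′ (win w w∉D w∉S)

  -- When Staller answers with a vertex she already owns in S′, Dominator replies as if she had taken
  -- the free vertex offered by the strategy for S′.
  WinD-⊆ : S ⊆ S′ → (∀ {v} → v ∈ S′ → v ∉ S → v ∉ D) → WinD G k D S′ → WinD G k D S
  WinS-⊆ : S ⊆ S′ → (∀ {v} → v ∈ S′ → v ∉ S → v ∉ D) → WinS G k D S′ → WinS G k D S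
  WinD-⊆ S⊆S′ new∉D (doneD dom) = doneD dom
  WinD-⊆ S⊆S′ new∉D (move v v∉D v∉S′ win) =
    move v v∉D (λ v∈S → v∉S′ (S⊆S′ v∈S))
      (WinS-⊆ S⊆S′ (λ u∈S′ u∉S → ∉-∪⁅⁆ (new∉D u∈S′ u∉S) λ { refl → v∉S′ u∈S′ }) win)
  WinS-⊆ S⊆S′ new∉D (doneS dom) = doneS dom
  WinS-⊆ {S = S} {S′} {D} S⊆S′ new∉D (stall (x , x∉D , x∉S′) win) =
    stall (x , x∉D , λ x∈S → x∉S′ (S⊆S′ x∈S)) reply
    where
    reply : ∀ w → w ∉ D → w ∉ S → WinD G _ D (S ∪ ⁅ w ⁆)
    reply w w∉D w∉S with w ∈? S′
    ... | no w∉S′ = WinD-⊆ S∪w⊆S′∪w new∉D′ (win w w∉D w∉S′)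
      where
      S∪w⊆S′∪w : S ∪ ⁅ w ⁆ ⊆ S′ ∪ ⁅ w ⁆
      S∪w⊆S′∪w u∈ with ∈-∪⁅⁆⁻ u∈
      ... | inj₁ u∈S = ⊆-∪⁅⁆ (S⊆S′ u∈S)
      ... | inj₂ refl = ∈-∪⁅⁆ʳ
      new∉D′ : ∀ {u} → u ∈ S′ ∪ ⁅ w ⁆ → u ∉ S ∪ ⁅ w ⁆ → u ∉ D
      new∉D′ u∈ u∉ with ∈-∪⁅⁆⁻ u∈
      ... | inj₁ u∈S′ = new∉D u∈S′ (λ u∈S → u∉ (⊆-∪⁅⁆ u∈S))
      ... | inj₂ refl = λ _ → u∉ ∈-∪⁅⁆ʳ
    ... | yes w∈S′ = WinD-⊆ S∪w⊆S′∪x new∉D′ (win x x∉D x∉S′)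
      where
      S∪w⊆S′∪x : S ∪ ⁅ w ⁆ ⊆ S′ ∪ ⁅ x ⁆
      S∪w⊆S′∪x u∈ with ∈-∪⁅⁆⁻ u∈
      ... | inj₁ u∈S = ⊆-∪⁅⁆ (S⊆S′ u∈S)
      ... | inj₂ refl = ⊆-∪⁅⁆ w∈S′
      new∉D′ : ∀ {u} → u ∈ S′ ∪ ⁅ x ⁆ → u ∉ S ∪ ⁅ w ⁆ → u ∉ D
      new∉D′ u∈ u∉ with ∈-∪⁅⁆⁻ u∈
      ... | inj₁ u∈S′ = new∉D u∈S′ (λ u∈S → u∉ (⊆-∪⁅⁆ u∈S))
      ... | inj₂ refl = x∉D

  WinS⇒WinD : WinS G k D S → WinD G k D S
  WinS⇒WinD (doneS dom) = doneD dom
  WinS⇒WinD {D = D} {S} (stall (w , w∉D , w∉S) win) = WinD-⊆ ⊆-∪⁅⁆ new∉D (win w w∉D w∉S)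
    where
    new∉D : ∀ {u} → u ∈ S ∪ ⁅ w ⁆ → u ∉ S → u ∉ D
    new∉D u∈ u∉S with ∈-∪⁅⁆⁻ u∈
    ... | inj₁ u∈S = ⊥-elim (u∉S u∈S)
    ... | inj₂ refl = w∉D

  WinD⇒dominating : WinD G k D S → ∃ λ D′ → Dominates G D′ × ∣ D′ ∣ ≤ ∣ D ∣ + k
  WinS⇒dominating : WinS G k D S → ∃ λ D′ → Dominates G D′ × ∣ D′ ∣ ≤ ∣ D ∣ + k
  WinD⇒dominating {D = D} (doneD dom) = D , dom , m≤m+n _ _
  WinD⇒dominating {suc k} {D} (move v _ _ win) with WinS⇒dominating win
  ... | D′ , dom , ∣D′∣≤ =
    D′ , dom , ≤-trans ∣D′∣≤ (subst (∣ D ∪ ⁅ v ⁆ ∣ + k ≤_) (sym (+-suc ∣ D ∣ k))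
                                    (+-monoˡ-≤ k (∣p∪⁅x⁆∣≤1+∣p∣ D v)))
  WinS⇒dominating {D = D} (doneS dom) = D , dom , m≤m+n _ _
  WinS⇒dominating (stall (w , w∉D , w∉S) win) = WinD⇒dominating (win w w∉D w∉S)

  γ≤γMB : ∀ {g a} → IsDomNum G g → IsγMB G a → fin g ≤∞ a
  γ≤γMB {a = fin k} (_ , minimal) (win , _) with WinD⇒dominating win
  ... | D′ , dom , ∣D′∣≤ =
    fin≤fin (≤-trans (minimal D′ dom) (subst (λ z → ∣ D′ ∣ ≤ z + k) (∣⊥∣≡0 n) ∣D′∣≤))
  γ≤γMB {a = ∞}     _             _         = _ ≤∞∞

  γMB≤γMB′ : ∀ {a b} → IsγMB G a → IsγMB' G b → a ≤∞ b
  γMB≤γMB′ {a}         {∞}     _             _         = a ≤∞∞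
  γMB≤γMB′ {fin j}     {fin k} (_ , minimal) (win , _) = fin≤fin (minimal k (WinS⇒WinD win))
  γMB≤γMB′ {∞}         {fin k} noWin         (win , _) = ⊥-elim (noWin k (WinS⇒WinD win))

-- Pairs of vertices, pairing strategies and the potential

module Pairing {n P : ℕ} (G : Graph n) (pair : Fin P → Bool → Fin n)
               (pair-injective : ∀ {i j x y} → pair i x ≡ pair j y → i ≡ j × x ≡ y) where

  private variable
    k m : ℕ
    D S : Subset n
    U R : Subset P
    i j : Fin P
    u v w h : Fin n
    x y : Bool

  claimed : Subset n → Subset P
  claimed D = tabulate λ i → lookup D (pair i false) ∨ lookup D (pair i true)

  claimed⁺ : pair i x ∈ D → i ∈ claimed D
  claimed⁺ {i} {x} {D} p∈D = lookup⇒[]= i _ (trans (lookup∘tabulate _ i) (side x ([]=⇒lookup p∈D)))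
    where
    side : ∀ x → lookup D (pair i x) ≡ true → lookup D (pair i false) ∨ lookup D (pair i true) ≡ true
    side false eq rewrite eq = refl
    side true  eq rewrite eq = ∨-zeroʳ _

  claimed⁻ : ∀ D → i ∈ claimed D → ∃ λ x → pair i x ∈ D
  claimed⁻ {i} D i∈ = side (trans (sym (lookup∘tabulate _ i)) ([]=⇒lookup i∈))
    where
    side : lookup D (pair i false) ∨ lookup D (pair i true) ≡ true → ∃ λ x → pair i x ∈ D
    side eq with lookup D (pair i false) in eq₀
    ... | true  = false , lookup⇒[]= _ D eq₀
    ... | false = true , lookup⇒[]= _ D eq

  claimed-∪⁅⁆⁻ : ∀ D → i ∈ claimed (D ∪ ⁅ v ⁆) → i ∈ claimed D ⊎ ∃ λ x → pair i x ≡ v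
  claimed-∪⁅⁆⁻ {v = v} D i∈ with claimed⁻ (D ∪ ⁅ v ⁆) i∈
  ... | x , p∈ with ∈-∪⁅⁆⁻ p∈
  ...   | inj₁ p∈D = inj₁ (claimed⁺ p∈D)
  ...   | inj₂ p≡v = inj₂ (x , p≡v)

  InPairs : Fin n → Subset P → Set
  InPairs v U = ∃ λ i → i ∈ U × ∃ λ x → pair i x ≡ v

  inPairs? : ∀ v U → Dec (InPairs v U)
  inPairs? v U = map′ (λ (i , i∈U , p≡v) → i , i∈U , side p≡v)
                      (λ (i , i∈U , x , p≡v) → i , i∈U , unside x p≡v)
                      (any? λ i → (i ∈? U) ×-dec (pair i false ≟ v ⊎-dec pair i true ≟ v))
    where
    side : ∀ {i} → pair i false ≡ v ⊎ pair i true ≡ v → ∃ λ x → pair i x ≡ v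
    side (inj₁ eq) = false , eq
    side (inj₂ eq) = true , eq
    unside : ∀ {i} x → pair i x ≡ v → pair i false ≡ v ⊎ pair i true ≡ v
    unside false eq = inj₁ eq
    unside true  eq = inj₂ eq

  ¬InPairs-∉ : j ∉ U → ¬ InPairs (pair j y) U
  ¬InPairs-∉ j∉U (i , i∈U , x , eq) with pair-injective eq
  ... | refl , _ = j∉U i∈U

  Disjoint : Subset P → Subset P → Set
  Disjoint U R = ∀ {i} → i ∈ U → i ∉ R

  InPairs⇒¬InPairs : Disjoint U R → InPairs w U → ¬ InPairs w R
  InPairs⇒¬InPairs U∩R (j , j∈U , y , refl) = ¬InPairs-∉ (U∩R j∈U)

  IsHub : Fin n → Set
  IsHub h = ∀ {i x} → pair i x ≢ h

  ¬InPairs-hub : IsHub h → ¬ InPairs h U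
  ¬InPairs-hub hub (_ , _ , _ , eq) = hub eq

  hub∪∅-unclaimed : IsHub h → ∀ {i x} → pair i x ∉ ∅ ∪ ⁅ h ⁆
  hub∪∅-unclaimed hub p∈ with ∈-∪⁅⁆⁻ p∈
  ... | inj₁ p∈∅ = ∉⊥ p∈∅
  ... | inj₂ eq  = hub eq

  Free : Subset n → Subset n → Fin n → Set
  Free D S v = v ∉ D × v ∉ S

  FreePairs : Subset P → Subset n → Subset n → Set
  FreePairs U D S = ∀ {i} → i ∈ U → ∀ x → Free D S (pair i x)

  Free-∪ : Free D S u → v ≢ u → w ≢ u → Free (D ∪ ⁅ v ⁆) (S ∪ ⁅ w ⁆) u
  Free-∪ (u∉D , u∉S) v≢u w≢u = ∉-∪⁅⁆ u∉D v≢u , ∉-∪⁅⁆ u∉S w≢u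

  FreePairs-∪ : FreePairs U D S → ¬ InPairs v U → ¬ InPairs w U →
                FreePairs U (D ∪ ⁅ v ⁆) (S ∪ ⁅ w ⁆)
  FreePairs-∪ free v∉ w∉ i∈U x =
    Free-∪ (free i∈U x) (λ eq → v∉ (_ , i∈U , x , sym eq)) (λ eq → w∉ (_ , i∈U , x , sym eq))

  FreePairs-∪ˡ : FreePairs U D S → ¬ InPairs v U → FreePairs U (D ∪ ⁅ v ⁆) S
  FreePairs-∪ˡ free v∉ i∈U x =
    ∉-∪⁅⁆ (proj₁ (free i∈U x)) (λ eq → v∉ (_ , i∈U , x , sym eq)) , proj₂ (free i∈U x)

  FreePairs-∪ʳ : FreePairs U D S → ¬ InPairs w U → FreePairs U D (S ∪ ⁅ w ⁆)
  FreePairs-∪ʳ free w∉ i∈U x =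
    proj₁ (free i∈U x) , ∉-∪⁅⁆ (proj₂ (free i∈U x)) (λ eq → w∉ (_ , i∈U , x , sym eq))

  FreePairs-⊆ : R ⊆ U → FreePairs U D S → FreePairs R D S
  FreePairs-⊆ R⊆U free i∈R = free (R⊆U i∈R)

  FreePairs-∪⁺ : FreePairs U D S → FreePairs R D S → FreePairs (U ∪ R) D S
  FreePairs-∪⁺ {U} {R = R} freeU freeR i∈ with x∈p∪q⁻ U R i∈
  ... | inj₁ i∈U = freeU i∈U
  ... | inj₂ i∈R = freeR i∈R

  SufficesUnder : (Subset n → Set) → Subset P → Subset n → Set
  SufficesUnder Q U D = ∀ {D′} → D ⊆ D′ → Q D′ → U ⊆ claimed D′ → Dominates G D′

  Suffices : Subset P → Subset n → Set
  Suffices = SufficesUnder λ _ → ⊤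

  SufficesUnder-claim : ∀ {Q} → SufficesUnder Q U D → SufficesUnder Q (U - j) (D ∪ ⁅ pair j x ⁆)
  SufficesUnder-claim suff {D′} D∪⊆ q U-j⊆ =
    suff (λ u∈D → D∪⊆ (⊆-∪⁅⁆ u∈D)) q (p-x⊆q⇒p⊆q (claimed⁺ {D = D′} (D∪⊆ ∈-∪⁅⁆ʳ)) U-j⊆)

  Suffices-empty : ¬ Nonempty U → Suffices U D → Dominates G D
  Suffices-empty empty suff = suff (λ u∈ → u∈) tt (λ i∈U → ⊥-elim (empty (_ , i∈U)))

  answerMate : j ∈ U → FreePairs U D S →
               (FreePairs (U - j) (D ∪ ⁅ pair j (not y) ⁆) (S ∪ ⁅ pair j y ⁆) →
                WinS G k (D ∪ ⁅ pair j (not y) ⁆) (S ∪ ⁅ pair j y ⁆)) →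
               WinD G (suc k) D (S ∪ ⁅ pair j y ⁆)
  answerMate {j} {U} {y = y} j∈U free continue =
    move (pair j (not y)) (proj₁ (free j∈U (not y)))
         (∉-∪⁅⁆ (proj₂ (free j∈U (not y))) (λ eq → not-¬ refl (proj₂ (pair-injective eq))))
         (continue (FreePairs-∪ (FreePairs-⊆ (p─q⊆p _ _) free)
                                (¬InPairs-∉ (x∉p-x U j)) (¬InPairs-∉ (x∉p-x U j))))

  pairing-D : ∀ m → ∣ U ∣ ≤ m → FreePairs U D S → Suffices U D → WinD G m D S
  pairing-S : ∀ m → ∣ U ∣ ≤ m → FreePairs U D S → Suffices U D → WinS G m D S
  pairing-D {U} m ∣U∣≤m free suff with nonempty? U
  ... | no empty = doneD (Suffices-empty empty suff)
  ... | yes (i , i∈U) with ∣p-x∣≤pred i∈U ∣U∣≤m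
  ...   | m′ , refl , ∣U-i∣≤m′ =
    move (pair i false) (proj₁ (free i∈U false)) (proj₂ (free i∈U false))
         (pairing-S m′ ∣U-i∣≤m′
           (FreePairs-∪ˡ (FreePairs-⊆ (p─q⊆p _ _) free) (¬InPairs-∉ (x∉p-x U i)))
           (SufficesUnder-claim suff))
  pairing-S {U} {D} {S} m ∣U∣≤m free suff with nonempty? U
  ... | no empty = doneS (Suffices-empty empty suff)
  ... | yes (i , i∈U) = stall (pair i false , free i∈U false) reply
    where
    reply : ∀ w → w ∉ D → w ∉ S → WinD G m D (S ∪ ⁅ w ⁆)
    reply w _ _ with inPairs? w U
    ... | no w∉U = pairing-D m ∣U∣≤m (FreePairs-∪ʳ free w∉U) suff
    ... | yes (j , j∈U , y , refl) with ∣p-x∣≤pred j∈U ∣U∣≤m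
    ...   | m′ , refl , ∣U-j∣≤m′ =
      answerMate j∈U free λ free′ → pairing-S m′ ∣U-j∣≤m′ free′ (SufficesUnder-claim suff)

  HubCovered : Fin n → Subset P → Subset n → Set
  HubCovered h R D = h ∈ D ⊎ R ⊆ claimed D

  oneHub-S : ∀ m → IsHub h → 1 ≤ ∣ R ∣ → Disjoint U R → ∣ U ∣ ≤ m →
             Free D S h → FreePairs R D S → FreePairs U D S → SufficesUnder (HubCovered h R) U D →
             WinS G (∣ R ∣ + m) D S
  oneHub-S {h} {R} {U} {D} {S} m hub R≢∅ U∩R ∣U∣≤m freeh freeR freeU suff = stall (h , freeh) reply
    where
    reply : ∀ w → w ∉ D → w ∉ S → WinD G (∣ R ∣ + m) D (S ∪ ⁅ w ⁆)
    reply w _ _ with w ≟ h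
    ... | yes refl =
      pairing-D (∣ R ∣ + m) (∣p∪q∣≤∣q∣+m U R ∣U∣≤m)
        (FreePairs-∪ʳ (FreePairs-∪⁺ freeU freeR) (¬InPairs-hub hub))
        λ D⊆ _ claims → suff D⊆ (inj₂ (λ i∈R → claims (q⊆p∪q U R i∈R)))
                                (λ i∈U → claims (p⊆p∪q R i∈U))
    ... | no w≢h with inPairs? w U
    ...   | no w∉U =
      WinD-mono (+-monoˡ-≤ m R≢∅)
        (move h (proj₁ freeh) (∉-∪⁅⁆ (proj₂ freeh) w≢h)
          (pairing-S m ∣U∣≤m (FreePairs-∪ freeU (¬InPairs-hub hub) w∉U)
            λ D∪⊆ _ → suff (λ u∈D → D∪⊆ (⊆-∪⁅⁆ u∈D)) (inj₁ (D∪⊆ ∈-∪⁅⁆ʳ))))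
    ...   | yes (j , j∈U , y , refl) with ∣p-x∣≤pred j∈U ∣U∣≤m
    ...     | m′ , refl , ∣U-j∣≤m′ =
      subst (λ k → WinD G k D (S ∪ ⁅ pair j y ⁆)) (sym (+-suc ∣ R ∣ m′))
        (answerMate j∈U freeU λ freeU′ →
          oneHub-S m′ hub R≢∅ (λ i∈ → U∩R (p─q⊆p _ _ i∈)) ∣U-j∣≤m′ (Free-∪ freeh hub hub)
            (FreePairs-∪ freeR (¬InPairs-∉ (U∩R j∈U)) (¬InPairs-∉ (U∩R j∈U))) freeU′
            (SufficesUnder-claim suff))

  twoHubs-S : ∀ {hA hB A B} m → IsHub hA → IsHub hB → hA ≢ hB → 1 ≤ ∣ B ∣ → ∣ B ∣ ≤ ∣ A ∣ →
              Disjoint U A → Disjoint U B → Disjoint B A → ∣ U ∣ ≤ m →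
              Free D S hA → Free D S hB → FreePairs A D S → FreePairs B D S → FreePairs U D S →
              SufficesUnder (λ D′ → HubCovered hA A D′ × HubCovered hB B D′) U D →
              WinS G (suc (∣ A ∣ + m)) D S
  twoHubs-S {U} {D} {S} {hA} {hB} {A} {B} m hubA hubB hA≢hB B≢∅ B≤A U∩A U∩B B∩A ∣U∣≤m
            freeA freeB freeAs freeBs freeU suff = stall (hA , freeA) reply
    where
    A≢∅ : 1 ≤ ∣ A ∣
    A≢∅ = ≤-trans B≢∅ B≤A

    hB≢hA : hB ≢ hA
    hB≢hA eq = hA≢hB (sym eq)

    extends : ∀ {v D′} → D ∪ ⁅ v ⁆ ⊆ D′ → D ⊆ D′
    extends D∪⊆ u∈D = D∪⊆ (⊆-∪⁅⁆ u∈D)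

    tookHA : WinD G (suc (∣ A ∣ + m)) D (S ∪ ⁅ hA ⁆)
    tookHA =
      move hB (proj₁ freeB) (∉-∪⁅⁆ (proj₂ freeB) hA≢hB)
        (pairing-S (∣ A ∣ + m) (∣p∪q∣≤∣q∣+m U A ∣U∣≤m)
          (FreePairs-∪ (FreePairs-∪⁺ freeU freeAs) (¬InPairs-hub hubB) (¬InPairs-hub hubA))
          λ D∪⊆ _ claims → suff (extends D∪⊆)
                                (inj₂ (λ i∈A → claims (q⊆p∪q U A i∈A)) , inj₁ (D∪⊆ ∈-∪⁅⁆ʳ))
                                (λ i∈U → claims (p⊆p∪q A i∈U)))

    tookHB : WinD G (suc (∣ A ∣ + m)) D (S ∪ ⁅ hB ⁆)
    tookHB =
      WinD-mono (s≤s (+-monoˡ-≤ m B≤A))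
        (move hA (proj₁ freeA) (∉-∪⁅⁆ (proj₂ freeA) hB≢hA)
          (pairing-S (∣ B ∣ + m) (∣p∪q∣≤∣q∣+m U B ∣U∣≤m)
            (FreePairs-∪ (FreePairs-∪⁺ freeU freeBs) (¬InPairs-hub hubA) (¬InPairs-hub hubB))
            λ D∪⊆ _ claims → suff (extends D∪⊆)
                                  (inj₁ (D∪⊆ ∈-∪⁅⁆ʳ) , inj₂ (λ i∈B → claims (q⊆p∪q U B i∈B)))
                                  (λ i∈U → claims (p⊆p∪q B i∈U))))

    tookB : w ≢ hA → w ≢ hB → ¬ InPairs w U → InPairs w B →
            WinD G (suc (∣ A ∣ + m)) D (S ∪ ⁅ w ⁆)
    tookB w≢hA w≢hB w∉U w∈B =
      move hB (proj₁ freeB) (∉-∪⁅⁆ (proj₂ freeB) w≢hB)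
        (oneHub-S m hubA A≢∅ U∩A ∣U∣≤m (Free-∪ freeA hB≢hA w≢hA)
          (FreePairs-∪ freeAs (¬InPairs-hub hubB) (InPairs⇒¬InPairs B∩A w∈B))
          (FreePairs-∪ freeU (¬InPairs-hub hubB) w∉U)
          λ D∪⊆ coverA → suff (extends D∪⊆) (coverA , inj₁ (D∪⊆ ∈-∪⁅⁆ʳ)))

    tookElsewhere : w ≢ hA → w ≢ hB → ¬ InPairs w U → ¬ InPairs w B →
                    WinD G (suc (∣ A ∣ + m)) D (S ∪ ⁅ w ⁆)
    tookElsewhere w≢hA w≢hB w∉U w∉B =
      WinD-mono (s≤s (+-monoˡ-≤ m B≤A))
        (move hA (proj₁ freeA) (∉-∪⁅⁆ (proj₂ freeA) w≢hA)
          (oneHub-S m hubB B≢∅ U∩B ∣U∣≤m (Free-∪ freeB hA≢hB w≢hB)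
            (FreePairs-∪ freeBs (¬InPairs-hub hubA) w∉B)
            (FreePairs-∪ freeU (¬InPairs-hub hubA) w∉U)
            λ D∪⊆ coverB → suff (extends D∪⊆) (inj₁ (D∪⊆ ∈-∪⁅⁆ʳ) , coverB)))

    tookU : j ∈ U → WinD G (suc (∣ A ∣ + m)) D (S ∪ ⁅ pair j y ⁆)
    tookU {j} {y} j∈U with ∣p-x∣≤pred j∈U ∣U∣≤m
    ... | m′ , refl , ∣U-j∣≤m′ =
      subst (λ k → WinD G k D (S ∪ ⁅ pair j y ⁆)) (cong suc (sym (+-suc ∣ A ∣ m′)))
        (answerMate j∈U freeU λ freeU′ →
          twoHubs-S m′ hubA hubB hA≢hB B≢∅ B≤A
            (λ i∈ → U∩A (p─q⊆p _ _ i∈)) (λ i∈ → U∩B (p─q⊆p _ _ i∈)) B∩A ∣U-j∣≤m′ (Free-∪ freeA hubA hubA) (Free-∪ freeB hubB hubB)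
            (FreePairs-∪ freeAs (¬InPairs-∉ (U∩A j∈U)) (¬InPairs-∉ (U∩A j∈U)))
            (FreePairs-∪ freeBs (¬InPairs-∉ (U∩B j∈U)) (¬InPairs-∉ (U∩B j∈U)))
            freeU′ (SufficesUnder-claim suff))

    reply : ∀ w → w ∉ D → w ∉ S → WinD G (suc (∣ A ∣ + m)) D (S ∪ ⁅ w ⁆)
    reply w _ _ with w ≟ hA | w ≟ hB | inPairs? w U | inPairs? w B
    ... | yes refl | _        | _                        | _       = tookHA
    ... | no _     | yes refl | _                        | _       = tookHB
    ... | no _     | no _     | yes (j , j∈U , y , refl) | _       = tookU j∈U
    ... | no w≢hA  | no w≢hB  | no w∉U                   | yes w∈B = tookB w≢hA w≢hB w∉U w∈B
    ... | no w≢hA  | no w≢hB  | no w∉U                   | no w∉B  = tookElsewhere w≢hA w≢hB w∉U w∉B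

  unmet : Subset P → Subset n → ℕ
  unmet R D = ∣ R ∩ ∁ (claimed D) ∣

  unmet-stable : ∀ R D → ¬ InPairs v R → unmet R D ≤ unmet R (D ∪ ⁅ v ⁆)
  unmet-stable {v} R D v∉R = p⊆q⇒∣p∣≤∣q∣ stillUnmet
    where
    stillUnmet : R ∩ ∁ (claimed D) ⊆ R ∩ ∁ (claimed (D ∪ ⁅ v ⁆))
    stillUnmet {i} i∈ with x∈p∩q⁻ R _ i∈
    ... | i∈R , i∉ = x∈p∩q⁺ (i∈R , x∉p⇒x∈∁p λ i∈D∪ →
      case claimed-∪⁅⁆⁻ D i∈D∪ of λ where
        (inj₁ i∈D)      → x∈∁p⇒x∉p i∉ i∈D
        (inj₂ (x , eq)) → v∉R (i , i∈R , x , eq))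

  unmet-step : ∀ R D v → unmet R D ≤ suc (unmet R (D ∪ ⁅ v ⁆))
  unmet-step R D v with inPairs? v R
  ... | no v∉R = m≤n⇒m≤1+n (unmet-stable R D v∉R)
  ... | yes (i , _ , x , refl) =
    ≤-trans (p⊆q⇒∣p∣≤∣q∣ unmetOrI) (∣p∪⁅x⁆∣≤1+∣p∣ (R ∩ ∁ (claimed (D ∪ ⁅ pair i x ⁆))) i)
    where
    unmetOrI : R ∩ ∁ (claimed D) ⊆ R ∩ ∁ (claimed (D ∪ ⁅ pair i x ⁆)) ∪ ⁅ i ⁆
    unmetOrI {j} j∈ with j ≟ i | x∈p∩q⁻ R _ j∈
    ... | yes refl | _       = ∈-∪⁅⁆ʳ
    ... | no j≢i   | j∈R , j∉ = ⊆-∪⁅⁆ (x∈p∩q⁺ (j∈R , x∉p⇒x∈∁p λ j∈D∪ →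
      case claimed-∪⁅⁆⁻ D j∈D∪ of λ where
        (inj₁ j∈D)      → x∈∁p⇒x∉p j∉ j∈D
        (inj₂ (y , eq)) → j≢i (proj₁ (pair-injective eq))))

  unmet-claimed : ∀ R D → R ⊆ claimed D → unmet R D ≡ 0
  unmet-claimed R D R⊆ = trans (cong ∣_∣ (Empty-unique none)) (∣⊥∣≡0 P)
    where
    none : ¬ Nonempty (R ∩ ∁ (claimed D))
    none (i , i∈) with x∈p∩q⁻ R _ i∈
    ... | i∈R , i∉ = x∈∁p⇒x∉p i∉ (R⊆ i∈R)

  unmet-unclaimed : ∀ R D → (∀ {i x} → pair i x ∉ D) → unmet R D ≡ ∣ R ∣
  unmet-unclaimed R D noPairs =
    cong ∣_∣ (⊆-antisym (λ i∈ → proj₁ (x∈p∩q⁻ R _ i∈))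
                        (λ i∈R → x∈p∩q⁺ (i∈R , x∉p⇒x∈∁p λ i∈ → noPairs (proj₂ (claimed⁻ D i∈)))))

  -- A lower bound on the moves Dominator still needs to dominate h and the pairs of R.
  hubPotential : Fin n → Subset P → Subset n → Subset n → ℕ
  hubPotential h R D S with h ∈? D | h ∈? S
  ... | yes _ | _     = 0
  ... | no _  | yes _ = unmet R D
  ... | no _  | no _  = 1 ⊓ unmet R D

  hubPotential-owned : ∀ h R D S → h ∈ D → hubPotential h R D S ≡ 0
  hubPotential-owned h R D S h∈D with h ∈? D | h ∈? S
  ... | yes _  | _ = refl
  ... | no h∉D | _ = ⊥-elim (h∉D h∈D)

  hubPotential-stolen : ∀ h R D S → h ∉ D → h ∈ S → hubPotential h R D S ≡ unmet R D
  hubPotential-stolen h R D S h∉D h∈S with h ∈? D | h ∈? S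
  ... | yes h∈D | _      = ⊥-elim (h∉D h∈D)
  ... | no _    | yes _  = refl
  ... | no _    | no h∉S = ⊥-elim (h∉S h∈S)

  hubPotential-free : ∀ h R D S → h ∉ D → h ∉ S → hubPotential h R D S ≡ 1 ⊓ unmet R D
  hubPotential-free h R D S h∉D h∉S with h ∈? D | h ∈? S
  ... | yes h∈D | _       = ⊥-elim (h∉D h∈D)
  ... | no _    | yes h∈S = ⊥-elim (h∉S h∈S)
  ... | no _    | no _    = refl

  hubPotential-covered : ∀ h R D S → HubCovered h R D → hubPotential h R D S ≡ 0
  hubPotential-covered h R D S covered with h ∈? D | h ∈? S | covered
  ... | yes _  | _     | _        = refl
  ... | no h∉D | _     | inj₁ h∈D = ⊥-elim (h∉D h∈D)
  ... | no _   | yes _ | inj₂ R⊆  = unmet-claimed R D R⊆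
  ... | no _   | no _  | inj₂ R⊆  = cong (1 ⊓_) (unmet-claimed R D R⊆)

  hubPotential-Staller : ∀ h R D S w → hubPotential h R D S ≤ hubPotential h R D (S ∪ ⁅ w ⁆)
  hubPotential-Staller h R D S w with h ∈? D | h ∈? S | h ∈? S ∪ ⁅ w ⁆
  ... | yes _ | _       | _        = z≤n
  ... | no _  | yes _   | yes _    = ≤-refl
  ... | no _  | yes h∈S | no h∉S∪w = ⊥-elim (h∉S∪w (⊆-∪⁅⁆ h∈S))
  ... | no _  | no _    | yes _    = m⊓n≤n 1 _
  ... | no _  | no _    | no _     = ≤-refl

  hubPotential-stable : ∀ h R D S v → v ≢ h → ¬ InPairs v R →
                        hubPotential h R D S ≤ hubPotential h R (D ∪ ⁅ v ⁆) S
  hubPotential-stable h R D S v v≢h v∉R with h ∈? D | h ∈? S | h ∈? D ∪ ⁅ v ⁆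
  ... | yes _  | _     | _        = z≤n
  ... | no h∉D | _     | yes h∈D∪ = ⊥-elim (∉-∪⁅⁆ h∉D v≢h h∈D∪)
  ... | no _   | yes _ | no _     = unmet-stable R D v∉R
  ... | no _   | no _  | no _     = ⊓-monoʳ-≤ 1 (unmet-stable R D v∉R)

  hubPotential-step : ∀ h R D S v → v ∉ S → hubPotential h R D S ≤ suc (hubPotential h R (D ∪ ⁅ v ⁆) S)
  hubPotential-step h R D S v v∉S with h ∈? D | h ∈? S | h ∈? D ∪ ⁅ v ⁆
  ... | yes _  | _       | _        = z≤n
  ... | no _   | no _    | _        = ≤-trans (m⊓n≤m 1 _) (s≤s z≤n)
  ... | no _   | yes _   | no _     = unmet-step R D v
  ... | no h∉D | yes h∈S | yes h∈D∪ with ∈-∪⁅⁆⁻ h∈D∪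
  ...   | inj₁ h∈D  = ⊥-elim (h∉D h∈D)
  ...   | inj₂ refl = ⊥-elim (v∉S h∈S)

  module Potential {hA hB : Fin n} {A B C : Subset P}
                   (hubA : IsHub hA) (hubB : IsHub hB) (hA≢hB : hA ≢ hB)
                   (A∩B : Disjoint A B) (A∩C : Disjoint A C) (B∩C : Disjoint B C)
                   (dominating⇒ : ∀ {D} → Dominates G D →
                                  HubCovered hA A D × HubCovered hB B D × C ⊆ claimed D)
                   where

    Φ : Subset n → Subset n → ℕ
    Φ D S = hubPotential hA A D S + hubPotential hB B D S + unmet C D

    Φ-dominating : Dominates G D → Φ D S ≡ 0
    Φ-dominating {D} {S} dom with dominating⇒ dom
    ... | coverA , coverB , C⊆
      rewrite hubPotential-covered hA A D S coverA | hubPotential-covered hB B D S coverB = unmet-claimed C D C⊆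

    Φ-Staller : ∀ D S w → Φ D S ≤ Φ D (S ∪ ⁅ w ⁆)
    Φ-Staller D S w =
      +-mono-≤ (+-mono-≤ (hubPotential-Staller hA A D S w) (hubPotential-Staller hB B D S w)) ≤-refl

    -- A vertex is a hub or lies in a pair of at most one region, so only one summand can drop.
    Φ-move : ∀ D S v → v ∉ S → Φ D S ≤ suc (Φ (D ∪ ⁅ v ⁆) S)
    Φ-move D S v v∉S with v ≟ hA | v ≟ hB | inPairs? v A | inPairs? v B
    ... | yes refl | _ | _ | _ =
      +-mono-≤ (+-mono-≤ (hubPotential-step hA A D S v v∉S)
                         (hubPotential-stable hB B D S v hA≢hB (¬InPairs-hub hubA)))
               (unmet-stable C D (¬InPairs-hub hubA))
    ... | no v≢hA | yes refl | _ | _ =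
      +-mono-≤-sucᵐ (hubPotential-stable hA A D S v v≢hA (¬InPairs-hub hubB))
                    (hubPotential-step hB B D S v v∉S)
                    (unmet-stable C D (¬InPairs-hub hubB))
    ... | no v≢hA | no v≢hB | yes v∈A | _ =
      +-mono-≤ (+-mono-≤ (hubPotential-step hA A D S v v∉S)
                         (hubPotential-stable hB B D S v v≢hB (InPairs⇒¬InPairs A∩B v∈A)))
               (unmet-stable C D (InPairs⇒¬InPairs A∩C v∈A))
    ... | no v≢hA | no v≢hB | no v∉A | yes v∈B =
      +-mono-≤-sucᵐ (hubPotential-stable hA A D S v v≢hA v∉A)
                    (hubPotential-step hB B D S v v∉S)
                    (unmet-stable C D (InPairs⇒¬InPairs B∩C v∈B))
    ... | no v≢hA | no v≢hB | no v∉A | no v∉B =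
      +-mono-≤-sucʳ (hubPotential-stable hA A D S v v≢hA v∉A)
                    (hubPotential-stable hB B D S v v≢hB v∉B)
                    (unmet-step C D v)

    WinD⇒Φ≤ : WinD G k D S → Φ D S ≤ k
    WinS⇒Φ≤ : WinS G k D S → Φ D S ≤ k
    WinD⇒Φ≤ {k} {D} {S} (doneD dom)         = subst (_≤ k) (sym (Φ-dominating {S = S} dom)) z≤n
    WinD⇒Φ≤ {D = D} {S} (move v _ v∉S win) = ≤-trans (Φ-move D S v v∉S) (s≤s (WinS⇒Φ≤ win))
    WinS⇒Φ≤ {k} {D} {S} (doneS dom)         = subst (_≤ k) (sym (Φ-dominating {S = S} dom)) z≤n
    WinS⇒Φ≤ {D = D} {S} (stall (w , w∉D , w∉S) win) =
      ≤-trans (Φ-Staller D S w) (WinD⇒Φ≤ (win w w∉D w∉S))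

    WinS⇒Φ[S∪w]≤ : WinS G k D S → Free D S w → Φ D (S ∪ ⁅ w ⁆) ≤ k
    WinS⇒Φ[S∪w]≤ {k} {D} {S} {w} (doneS dom) _ =
      subst (_≤ k) (sym (Φ-dominating {S = S ∪ ⁅ w ⁆} dom)) z≤n
    WinS⇒Φ[S∪w]≤ (stall _ win) (w∉D , w∉S) = WinD⇒Φ≤ (win _ w∉D w∉S)

    Φ∅∅≤∣D∣+Φ : ∀ m D → ∣ D ∣ ≤ m → Φ ∅ ∅ ≤ ∣ D ∣ + Φ D ∅
    Φ∅∅≤∣D∣+Φ m D ∣D∣≤m with nonempty? D
    ... | no empty rewrite Empty-unique empty | ∣⊥∣≡0 n = ≤-refl
    ... | yes (v , v∈D) with ∣p-x∣≤pred v∈D ∣D∣≤m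
    ...   | m′ , refl , ∣D-v∣≤m′ = begin
      Φ ∅ ∅                                   ≤⟨ Φ∅∅≤∣D∣+Φ m′ (D - v) ∣D-v∣≤m′ ⟩
      ∣ D - v ∣ + Φ (D - v) ∅                 ≤⟨ +-monoʳ-≤ ∣ D - v ∣ (Φ-move (D - v) ∅ v ∉⊥) ⟩
      ∣ D - v ∣ + suc (Φ ((D - v) ∪ ⁅ v ⁆) ∅) ≡⟨ +-suc ∣ D - v ∣ _ ⟩
      suc ∣ D - v ∣ + Φ ((D - v) ∪ ⁅ v ⁆) ∅   ≡⟨ cong (λ E → suc ∣ D - v ∣ + Φ E ∅) (sym (p≡p-x∪⁅x⁆ v∈D)) ⟩
      suc ∣ D - v ∣ + Φ D ∅                   ≤⟨ +-monoˡ-≤ (Φ D ∅) (x∈p⇒∣p-x∣<∣p∣ v∈D) ⟩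
      ∣ D ∣ + Φ D ∅                           ∎
      where open ≤-Reasoning

    module _ (A≢∅ : 1 ≤ ∣ A ∣) (B≢∅ : 1 ≤ ∣ B ∣) where

      Φ-start : Φ ∅ ∅ ≡ 2 + ∣ C ∣
      Φ-start
        rewrite hubPotential-free hA A ∅ ∅ ∉⊥ ∉⊥ | hubPotential-free hB B ∅ ∅ ∉⊥ ∉⊥
              | unmet-unclaimed A ∅ ∉⊥ | unmet-unclaimed B ∅ ∉⊥ | unmet-unclaimed C ∅ ∉⊥
              | 1⊓n≡1 A≢∅ | 1⊓n≡1 B≢∅ = refl

      Φ-hA-stolen : Φ ∅ (∅ ∪ ⁅ hA ⁆) ≡ suc (∣ A ∣ + ∣ C ∣)
      Φ-hA-stolen
        rewrite hubPotential-stolen hA A ∅ (∅ ∪ ⁅ hA ⁆) ∉⊥ ∈-∪⁅⁆ʳ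
              | hubPotential-free hB B ∅ (∅ ∪ ⁅ hA ⁆) ∉⊥ (∉-∪⁅⁆ ∉⊥ hA≢hB)
              | unmet-unclaimed A ∅ ∉⊥ | unmet-unclaimed B ∅ ∉⊥ | unmet-unclaimed C ∅ ∉⊥
              | 1⊓n≡1 B≢∅ = cong (_+ ∣ C ∣) (+-comm ∣ A ∣ 1)

      Φ-hA-owned-hB-stolen : Φ (∅ ∪ ⁅ hA ⁆) (∅ ∪ ⁅ hB ⁆) ≡ ∣ B ∣ + ∣ C ∣
      Φ-hA-owned-hB-stolen
        rewrite hubPotential-owned hA A (∅ ∪ ⁅ hA ⁆) (∅ ∪ ⁅ hB ⁆) ∈-∪⁅⁆ʳ
              | hubPotential-stolen hB B (∅ ∪ ⁅ hA ⁆) (∅ ∪ ⁅ hB ⁆) (∉-∪⁅⁆ ∉⊥ hA≢hB) ∈-∪⁅⁆ʳ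
              | unmet-unclaimed B (∅ ∪ ⁅ hA ⁆) (hub∪∅-unclaimed hubA)
              | unmet-unclaimed C (∅ ∪ ⁅ hA ⁆) (hub∪∅-unclaimed hubA) = refl

      dominating⇒2+∣C∣≤∣D∣ : Dominates G D → 2 + ∣ C ∣ ≤ ∣ D ∣
      dominating⇒2+∣C∣≤∣D∣ {D} dom =
        subst₂ _≤_ Φ-start (trans (cong (∣ D ∣ +_) (Φ-dominating {S = ∅} dom)) (+-identityʳ ∣ D ∣))
               (Φ∅∅≤∣D∣+Φ ∣ D ∣ D ≤-refl)

      -- Staller opens on hA.
      WinS⇒∣A∣+∣C∣<k : WinS G k ∅ ∅ → suc (∣ A ∣ + ∣ C ∣) ≤ k
      WinS⇒∣A∣+∣C∣<k {k} win = subst (_≤ k) Φ-hA-stolen (WinS⇒Φ[S∪w]≤ win (∉⊥ , ∉⊥))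

      -- Staller answers hB if Dominator opened on hA, and hA otherwise.
      WinD⇒∣B∣+∣C∣<k : ∣ B ∣ ≤ ∣ A ∣ → WinD G k ∅ ∅ → suc (∣ B ∣ + ∣ C ∣) ≤ k
      WinD⇒∣B∣+∣C∣<k _ (doneD dom) with trans (sym Φ-start) (Φ-dominating {S = ∅} dom)
      ... | ()
      WinD⇒∣B∣+∣C∣<k {suc k} B≤A (move v _ _ win) with v ≟ hA
      ... | yes refl =
        s≤s (subst (_≤ k) Φ-hA-owned-hB-stolen (WinS⇒Φ[S∪w]≤ win (∉-∪⁅⁆ ∉⊥ hA≢hB , ∉⊥)))
      ... | no v≢hA  = s≤s (≤-trans (+-monoˡ-≤ ∣ C ∣ B≤A) (≤-pred (begin
        suc (∣ A ∣ + ∣ C ∣)              ≡⟨ sym Φ-hA-stolen ⟩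
        Φ ∅ (∅ ∪ ⁅ hA ⁆)                ≤⟨ Φ-move ∅ (∅ ∪ ⁅ hA ⁆) v (∉-∪⁅⁆ ∉⊥ λ eq → v≢hA (sym eq)) ⟩
        suc (Φ (∅ ∪ ⁅ v ⁆) (∅ ∪ ⁅ hA ⁆)) ≤⟨ s≤s (WinS⇒Φ[S∪w]≤ win (∉-∪⁅⁆ ∉⊥ v≢hA , ∉⊥)) ⟩
        suc k                            ∎)))
        where open ≤-Reasoning

-- The hub graphs

data Vertex (P : ℕ) : Set where
  hubA hubB : Vertex P
  pairV     : Fin P → Bool → Vertex P

module Encoding (P : ℕ) where

  encode : Vertex P → Fin (2 + (P + P))
  encode hubA            = zero
  encode hubB            = suc zero
  encode (pairV i false) = suc (suc (i ↑ˡ P))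
  encode (pairV i true)  = suc (suc (P ↑ʳ i))

  decode : Fin (2 + (P + P)) → Vertex P
  decode zero          = hubA
  decode (suc zero)    = hubB
  decode (suc (suc k)) = [ (λ i → pairV i false) , (λ i → pairV i true) ]′ (splitAt P k)

  decode-encode : ∀ v → decode (encode v) ≡ v
  decode-encode hubA            = refl
  decode-encode hubB            = refl
  decode-encode (pairV i false) rewrite splitAt-↑ˡ P i P = refl
  decode-encode (pairV i true)  rewrite splitAt-↑ʳ P P i = refl

  encode-decode : ∀ k → encode (decode k) ≡ k
  encode-decode zero          = refl
  encode-decode (suc zero)    = refl
  encode-decode (suc (suc k)) with splitAt P k in eq
  ... | inj₁ i = cong (λ k → suc (suc k)) (splitAt⁻¹-↑ˡ eq)
  ... | inj₂ i = cong (λ k → suc (suc k)) (splitAt⁻¹-↑ʳ eq)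

  encode-injective : ∀ {v w} → encode v ≡ encode w → v ≡ w
  encode-injective {v} {w} eq = trans (sym (decode-encode v)) (trans (cong decode eq) (decode-encode w))

does-≟-sym : ∀ {P} (i j : Fin P) → does (i ≟ j) ≡ does (j ≟ i)
does-≟-sym i j with i ≟ j | j ≟ i
... | yes _  | yes _  = refl
... | no _   | no _   = refl
... | yes eq | no neq = ⊥-elim (neq (sym eq))
... | no neq | yes eq = ⊥-elim (neq (sym eq))

data Region : Set where
  regionA regionB regionC : Region

_≡ᵇ_ : Region → Region → Bool
regionA ≡ᵇ regionA = true
regionB ≡ᵇ regionB = true
regionC ≡ᵇ regionC = true
_       ≡ᵇ _       = false

≡ᵇ⇒≡ : ∀ r s → r ≡ᵇ s ≡ true → r ≡ s
≡ᵇ⇒≡ regionA regionA _ = refl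
≡ᵇ⇒≡ regionB regionB _ = refl
≡ᵇ⇒≡ regionC regionC _ = refl
≡ᵇ⇒≡ regionA regionB ()
≡ᵇ⇒≡ regionA regionC ()
≡ᵇ⇒≡ regionB regionA ()
≡ᵇ⇒≡ regionB regionC ()
≡ᵇ⇒≡ regionC regionA ()
≡ᵇ⇒≡ regionC regionB ()

≡ᵇ-refl : ∀ r → r ≡ᵇ r ≡ true
≡ᵇ-refl regionA = refl
≡ᵇ-refl regionB = refl
≡ᵇ-refl regionC = refl

module HubGraph {P : ℕ} (labels : Vec Region P) where

  open Encoding P

  region : Region → Subset P
  region r = map (_≡ᵇ r) labels

  ∈region⁻ : ∀ {i r} → i ∈ region r → lookup labels i ≡ r
  ∈region⁻ {i} {r} i∈ = ≡ᵇ⇒≡ _ r (trans (sym (lookup-map i (_≡ᵇ r) labels)) ([]=⇒lookup i∈))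

  ∈region⁺ : ∀ i → i ∈ region (lookup labels i)
  ∈region⁺ i = lookup⇒[]= i _ (trans (lookup-map i _ labels) (≡ᵇ-refl (lookup labels i)))

  region-disjoint : ∀ {r s i} → r ≢ s → i ∈ region r → i ∉ region s
  region-disjoint r≢s i∈r i∈s = r≢s (trans (sym (∈region⁻ i∈r)) (∈region⁻ i∈s))

  A B C : Subset P
  A = region regionA
  B = region regionB
  C = region regionC

  adjacent : Vertex P → Vertex P → Bool
  adjacent hubA        hubA        = false
  adjacent hubA        hubB        = false
  adjacent hubB        hubA        = false
  adjacent hubB        hubB        = false
  adjacent hubA        (pairV i _) = lookup A i
  adjacent hubB        (pairV i _) = lookup B i
  adjacent (pairV i _) hubA        = lookup A i
  adjacent (pairV i _) hubB        = lookup B i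
  adjacent (pairV i x) (pairV j y) = does (i ≟ j) ∧ (x xor y)

  adjacent-sym : ∀ v w → adjacent v w ≡ adjacent w v
  adjacent-sym hubA        hubA        = refl
  adjacent-sym hubA        hubB        = refl
  adjacent-sym hubB        hubA        = refl
  adjacent-sym hubB        hubB        = refl
  adjacent-sym hubA        (pairV i _) = refl
  adjacent-sym hubB        (pairV i _) = refl
  adjacent-sym (pairV i _) hubA        = refl
  adjacent-sym (pairV i _) hubB        = refl
  adjacent-sym (pairV i x) (pairV j y) = cong₂ _∧_ (does-≟-sym i j) (xor-comm x y)

  adjacent-irrefl : ∀ v → adjacent v v ≡ false
  adjacent-irrefl hubA        = refl
  adjacent-irrefl hubB        = refl
  adjacent-irrefl (pairV i x) = trans (cong (does (i ≟ i) ∧_) (xor-same x)) (∧-zeroʳ _)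

  mates-adjacent : ∀ i {x y} → x ≢ y → adjacent (pairV i x) (pairV i y) ≡ true
  mates-adjacent i {x} {y} x≢y with i ≟ i
  ... | no i≢i = ⊥-elim (i≢i refl)
  ... | yes _ with x | y
  ...   | false | true  = refl
  ...   | true  | false = refl
  ...   | false | false = ⊥-elim (x≢y refl)
  ...   | true  | true  = ⊥-elim (x≢y refl)

  N : ℕ
  N = 2 + (P + P)

  graph : Graph N
  graph = record
    { adj    = λ u v → adjacent (decode u) (decode v)
    ; sym    = λ u v → adjacent-sym (decode u) (decode v)
    ; irrefl = λ v → adjacent-irrefl (decode v)
    }

  adj-encode : ∀ v w → adj graph (encode v) (encode w) ≡ adjacent v w
  adj-encode v w rewrite decode-encode v | decode-encode w = refl

  neighbour⁻ : ∀ u w → adj graph u (encode w) ≡ true → ∃ λ v → u ≡ encode v × adjacent v w ≡ true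
  neighbour⁻ u w adj≡ =
    decode u , sym (encode-decode u) ,
    trans (sym (adj-encode (decode u) w))
          (subst (λ u′ → adj graph u′ (encode w) ≡ true) (sym (encode-decode u)) adj≡)

  pair : Fin P → Bool → Fin N
  pair i x = encode (pairV i x)

  pair-injective : ∀ {i j x y} → pair i x ≡ pair j y → i ≡ j × x ≡ y
  pair-injective eq with encode-injective eq
  ... | refl = refl , refl

  hA hB : Fin N
  hA = encode hubA
  hB = encode hubB

  hA≢hB : hA ≢ hB
  hA≢hB ()

  open Pairing graph pair pair-injective

  hA-IsHub : IsHub hA
  hA-IsHub {x = false} ()
  hA-IsHub {x = true}  ()

  hB-IsHub : IsHub hB
  hB-IsHub {x = false} ()
  hB-IsHub {x = true}  ()

  Dominated : Subset N → Fin N → Set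
  Dominated D v = v ∈ D ⊎ ∃ λ u → u ∈ D × adj graph u v ≡ true

  dominated-pair⁻ : ∀ {D i x} → Dominated D (pair i x) →
                    i ∈ claimed D ⊎ (hA ∈ D × i ∈ A) ⊎ (hB ∈ D × i ∈ B)
  dominated-pair⁻ (inj₁ p∈D) = inj₁ (claimed⁺ p∈D)
  dominated-pair⁻ {i = i} {x} (inj₂ (u , u∈D , adj≡)) with neighbour⁻ u (pairV i x) adj≡
  ... | hubA , refl , i∈A = inj₂ (inj₁ (u∈D , lookup⇒[]= i A i∈A))
  ... | hubB , refl , i∈B = inj₂ (inj₂ (u∈D , lookup⇒[]= i B i∈B))
  ... | pairV j y , refl , mates with j ≟ i
  ...   | yes refl = inj₁ (claimed⁺ u∈D)
  ...   | no _     with mates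
  ...     | ()

  A∩B : Disjoint A B
  A∩B = region-disjoint λ ()

  A∩C : Disjoint A C
  A∩C = region-disjoint λ ()

  B∩C : Disjoint B C
  B∩C = region-disjoint λ ()

  dominating⇒ : ∀ {D} → Dominates graph D → HubCovered hA A D × HubCovered hB B D × C ⊆ claimed D
  dominating⇒ {D} dom =
    coverA , coverB , λ i∈C → claimedUnless (λ _ i∈A → A∩C i∈A i∈C) (λ _ i∈B → B∩C i∈B i∈C)
    where
    claimedUnless : ∀ {i} → (hA ∈ D → i ∉ A) → (hB ∈ D → i ∉ B) → i ∈ claimed D
    claimedUnless {i} ¬A ¬B with dominated-pair⁻ {D} {i} {false} (dom (pair i false))
    ... | inj₁ i∈                   = i∈
    ... | inj₂ (inj₁ (hA∈D , i∈A)) = ⊥-elim (¬A hA∈D i∈A)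
    ... | inj₂ (inj₂ (hB∈D , i∈B)) = ⊥-elim (¬B hB∈D i∈B)
    coverA : HubCovered hA A D
    coverA with hA ∈? D
    ... | yes hA∈D = inj₁ hA∈D
    ... | no hA∉D  = inj₂ λ i∈A → claimedUnless (λ hA∈D → ⊥-elim (hA∉D hA∈D))
                                                (λ _ i∈B → A∩B i∈A i∈B)
    coverB : HubCovered hB B D
    coverB with hB ∈? D
    ... | yes hB∈D = inj₁ hB∈D
    ... | no hB∉D  = inj₂ λ i∈B → claimedUnless (λ _ i∈A → A∩B i∈A i∈B)
                                                (λ hB∈D → ⊥-elim (hB∉D hB∈D))

  dominating⇐ : ∀ {D} → Nonempty A → Nonempty B →
                HubCovered hA A D → HubCovered hB B D → C ⊆ claimed D → Dominates graph D
  dominating⇐ {D} (iA , iA∈A) (iB , iB∈B) coverA coverB C⊆ v =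
    subst (Dominated D) (encode-decode v) (dominatedVertex (decode v))
    where
    claimed⇒dominated : ∀ {i} x → i ∈ claimed D → Dominated D (pair i x)
    claimed⇒dominated {i} x i∈ with claimed⁻ D i∈
    ... | y , p∈D with y ≟ᴮ x
    ...   | yes refl = inj₁ p∈D
    ...   | no y≢x   = inj₂ (pair i y , p∈D , trans (adj-encode (pairV i y) (pairV i x)) (mates-adjacent i y≢x))
    hub⇒dominated : ∀ {h R i} → HubCovered (encode h) R D → i ∈ R → (∀ x → adjacent (pairV i x) h ≡ true) →
                    Dominated D (encode h)
    hub⇒dominated (inj₁ h∈D) _ _ = inj₁ h∈D
    hub⇒dominated {h} {i = i} (inj₂ R⊆) i∈R adj≡ with claimed⁻ D (R⊆ i∈R)
    ... | x , p∈D = inj₂ (pair i x , p∈D , trans (adj-encode (pairV i x) h) (adj≡ x))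
    covered⇒dominated : ∀ {h i R} x → HubCovered (encode h) R D → i ∈ R → adjacent h (pairV i x) ≡ true →
                        Dominated D (pair i x)
    covered⇒dominated {h} {i} x (inj₁ h∈D) _ adj≡ =
      inj₂ (encode h , h∈D , trans (adj-encode h (pairV i x)) adj≡)
    covered⇒dominated x (inj₂ R⊆) i∈R _ = claimed⇒dominated x (R⊆ i∈R)
    dominatedVertex : ∀ v → Dominated D (encode v)
    dominatedVertex hubA = hub⇒dominated {hubA} coverA iA∈A λ _ → []=⇒lookup iA∈A
    dominatedVertex hubB = hub⇒dominated {hubB} coverB iB∈B λ _ → []=⇒lookup iB∈B
    dominatedVertex (pairV i x) with lookup labels i | ∈region⁺ i
    ... | regionA | i∈A = covered⇒dominated {hubA} x coverA i∈A ([]=⇒lookup i∈A)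
    ... | regionB | i∈B = covered⇒dominated {hubB} x coverB i∈B ([]=⇒lookup i∈B)
    ... | regionC | i∈C = claimed⇒dominated x (C⊆ i∈C)

  -- The two hubs together with the first vertex of every C-pair (pair i false is vertex 2 + i).
  smallDominatingSet : Subset N
  smallDominatingSet = inside ∷ inside ∷ (C ++ ∅)

  ∣smallDominatingSet∣ : ∣ smallDominatingSet ∣ ≡ 2 + ∣ C ∣
  ∣smallDominatingSet∣ =
    cong (2 +_) (trans (∣p++q∣≡∣p∣+∣q∣ C ∅) (trans (cong (∣ C ∣ +_) (∣⊥∣≡0 P)) (+-identityʳ ∣ C ∣)))

  FreePairs-∅ : ∀ {U} → FreePairs U ∅ ∅
  FreePairs-∅ _ _ = ∉⊥ , ∉⊥

  module _ (B≢∅ : 1 ≤ ∣ B ∣) (B≤A : ∣ B ∣ ≤ ∣ A ∣) where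

    private
      A≢∅ : 1 ≤ ∣ A ∣
      A≢∅ = ≤-trans B≢∅ B≤A

    open Potential hA-IsHub hB-IsHub hA≢hB A∩B A∩C B∩C dominating⇒

    dominating : ∀ {D} → HubCovered hA A D → HubCovered hB B D → C ⊆ claimed D → Dominates graph D
    dominating = dominating⇐ (1≤∣p∣⇒nonempty A≢∅) (1≤∣p∣⇒nonempty B≢∅)

    γ≡2+∣C∣ : IsDomNum graph (2 + ∣ C ∣)
    γ≡2+∣C∣ =
        ( smallDominatingSet
        , dominating (inj₁ here) (inj₁ (there here))
                     (λ i∈C → claimed⁺ {x = false} {D = smallDominatingSet} (there (there (∈-++ˡ i∈C))))
        , ∣smallDominatingSet∣)
      , λ D dom → dominating⇒2+∣C∣≤∣D∣ A≢∅ B≢∅ dom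

    -- Dominator opens on hA and then plays the one-hub strategy on hB.
    γMB≡1+∣B∣+∣C∣ : IsγMB graph (fin (suc (∣ B ∣ + ∣ C ∣)))
    γMB≡1+∣B∣+∣C∣ =
        move hA ∉⊥ ∉⊥
          (oneHub-S ∣ C ∣ hB-IsHub B≢∅ (region-disjoint λ ()) ≤-refl (∉-∪⁅⁆ ∉⊥ hA≢hB , ∉⊥)
            (FreePairs-∪ˡ FreePairs-∅ (¬InPairs-hub hA-IsHub))
            (FreePairs-∪ˡ FreePairs-∅ (¬InPairs-hub hA-IsHub))
            λ ∅∪hA⊆ coverB → dominating (inj₁ (∅∪hA⊆ (∈-∪⁅⁆ʳ {D = ∅}))) coverB)
      , λ k win → WinD⇒∣B∣+∣C∣<k A≢∅ B≢∅ B≤A win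

    γMB′≡1+∣A∣+∣C∣ : IsγMB' graph (fin (suc (∣ A ∣ + ∣ C ∣)))
    γMB′≡1+∣A∣+∣C∣ =
        twoHubs-S ∣ C ∣ hA-IsHub hB-IsHub hA≢hB B≢∅ B≤A (region-disjoint λ ()) (region-disjoint λ ())
          (region-disjoint λ ()) ≤-refl (∉⊥ , ∉⊥) (∉⊥ , ∉⊥) FreePairs-∅ FreePairs-∅ FreePairs-∅
          (λ _ (coverA , coverB) → dominating coverA coverB)
      , λ k win → WinS⇒∣A∣+∣C∣<k A≢∅ B≢∅ win

labels : ∀ a b c → Vec Region (a + (b + c))
labels a b c = replicate a regionA ++ (replicate b regionB ++ replicate c regionC)

module _ (a b c : ℕ) where

  open HubGraph (labels a b c)

  ∣region∣ : ∀ r → ∣ region r ∣ ≡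
                   ∣ replicate a (regionA ≡ᵇ r) ∣ + (∣ replicate b (regionB ≡ᵇ r) ∣ + ∣ replicate c (regionC ≡ᵇ r) ∣)
  ∣region∣ r =
    trans (∣map-++∣ (replicate a regionA) _)
          (cong₂ _+_ (∣map-replicate∣ a regionA)
                     (trans (∣map-++∣ (replicate b regionB) _)
                            (cong₂ _+_ (∣map-replicate∣ b regionB) (∣map-replicate∣ c regionC))))
    where
    ∣map-++∣ : ∀ {m k} (xs : Vec Region m) (ys : Vec Region k) →
               ∣ map (_≡ᵇ r) (xs ++ ys) ∣ ≡ ∣ map (_≡ᵇ r) xs ∣ + ∣ map (_≡ᵇ r) ys ∣
    ∣map-++∣ xs ys = trans (cong ∣_∣ (map-++ (_≡ᵇ r) xs ys)) (∣p++q∣≡∣p∣+∣q∣ (map (_≡ᵇ r) xs) _)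
    ∣map-replicate∣ : ∀ m s → ∣ map (_≡ᵇ r) (replicate m s) ∣ ≡ ∣ replicate m (s ≡ᵇ r) ∣
    ∣map-replicate∣ m s = cong ∣_∣ (map-replicate (_≡ᵇ r) s m)

  ∣A∣≡a : ∣ A ∣ ≡ a
  ∣A∣≡a = trans (∣region∣ regionA)
                (trans (cong₂ _+_ (∣⊤∣≡n a) (cong₂ _+_ (∣⊥∣≡0 b) (∣⊥∣≡0 c))) (+-identityʳ a))

  ∣B∣≡b : ∣ B ∣ ≡ b
  ∣B∣≡b = trans (∣region∣ regionB)
                (trans (cong₂ _+_ (∣⊥∣≡0 a) (cong₂ _+_ (∣⊤∣≡n b) (∣⊥∣≡0 c))) (+-identityʳ b))

  ∣C∣≡c : ∣ C ∣ ≡ c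
  ∣C∣≡c = trans (∣region∣ regionC) (cong₂ _+_ (∣⊥∣≡0 a) (cong₂ _+_ (∣⊥∣≡0 b) (∣⊤∣≡n c)))

  hubGraph-realises : 1 ≤ b → b ≤ a → Σ ℕ λ n → Σ (Graph n) λ G →
                      IsDomNum G (2 + c) × IsγMB G (fin (suc (b + c))) × IsγMB' G (fin (suc (a + c)))
  hubGraph-realises 1≤b b≤a =
      N , graph
    , subst (λ c′ → IsDomNum graph (2 + c′)) ∣C∣≡c (γ≡2+∣C∣ 1≤∣B∣ ∣B∣≤∣A∣)
    , subst₂ (λ b′ c′ → IsγMB graph (fin (suc (b′ + c′)))) ∣B∣≡b ∣C∣≡c (γMB≡1+∣B∣+∣C∣ 1≤∣B∣ ∣B∣≤∣A∣)
    , subst₂ (λ a′ c′ → IsγMB' graph (fin (suc (a′ + c′)))) ∣A∣≡a ∣C∣≡c (γMB′≡1+∣A∣+∣C∣ 1≤∣B∣ ∣B∣≤∣A∣)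
    where
    1≤∣B∣ : 1 ≤ ∣ B ∣
    1≤∣B∣ = subst (1 ≤_) (sym ∣B∣≡b) 1≤b
    ∣B∣≤∣A∣ : ∣ B ∣ ≤ ∣ A ∣
    ∣B∣≤∣A∣ = subst₂ _≤_ (sym ∣B∣≡b) (sym ∣A∣≡a) b≤a

-- r = c + 2, s = b + c + 1 and t = a + c + 1 with a = 1 + p + q and b = 1 + p.
realisable : (r s t : ℕ) → 2 ≤ r → r ≤ s → s ≤ t →
             Σ ℕ λ n → Σ (Graph n) λ G → IsDomNum G r × IsγMB G (fin s) × IsγMB' G (fin t)
realisable r s t 2≤r r≤s s≤t with m≤n⇒∃[o]m+o≡n 2≤r | m≤n⇒∃[o]m+o≡n r≤s | m≤n⇒∃[o]m+o≡n s≤t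
... | c , refl | p , refl | q , refl with hubGraph-realises (suc (p + q)) (suc p) c (s≤s z≤n) (s≤s (m≤m+n p q))
...   | n , G , γ , γMB , γMB′ =
  n , G , γ , subst (λ s → IsγMB G (fin s)) (s-value c p) γMB
            , subst (λ t → IsγMB' G (fin t)) (t-value c p q) γMB′
  where
  s-value : ∀ c p → suc (suc p + c) ≡ 2 + c + p
  s-value = solve-∀
  t-value : ∀ c p q → suc (suc (p + q) + c) ≡ 2 + c + p + q
  t-value = solve-∀

theorem3p1 :
    ((n : ℕ) (G : Graph n) (g : ℕ) (a b : ℕ∞) →
      IsDomNum G g → IsγMB G a → IsγMB' G b →
      (fin g ≤∞ a) × (a ≤∞ b))
    ×
    ((r s t : ℕ) → 2 ≤ r → r ≤ s → s ≤ t →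
      Σ ℕ λ n → Σ (Graph n) λ G →
        IsDomNum G r × IsγMB G (fin s) × IsγMB' G (fin t))
theorem3p1 =
    (λ n G g a b γ γMB γMB′ → γ≤γMB {G = G} γ γMB , γMB≤γMB′ {G = G} γMB γMB′)
  , realisable
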